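{- Let $b=2^e p$ where $e\in\{0,1,2,3\}$ and $p$ is an odd prime, and let $a_1,a_2\in\mathbb{N}$ with $\gcd(a_1,b)=\gcd(a_2,b)=1$. Then $s(a_1,b)=s(a_2,b)$ if and only if $a_1\equiv a_2 \pmod{b}$ or $a_1\equiv a_2^{ -1}\pmod{b}$.
   Context: For coprime $a,b$, $s(a,b)=\sum_{k=1}^{b-1}\left(\left(\frac{k}{b}\right)\right)\left(\left(\frac{ak}{b}\right)\right)$ is the Dedekind sum, where $((x)) = x-\lfloor x\rfloor-\tfrac12$ if $x\notin\mathbb{Z}$ and $((x))=0$ if $x\in\mathbb{Z}$. Here $a_2^{ -1}$ denotes the inverse of $a_2$ modulo $b$. -}

module Defs where

open import Data.Nat as ℕ using (ℕ; suc; NonZero)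
open import Data.Nat.DivMod using (_%_)
open import Data.Integer as ℤ using (ℤ; +_)
open import Data.Rational as ℚ using (ℚ; ↧ₙ_; floor; _-_; _+_; _*_; 0ℚ; ½)
open import Data.List using (List; foldr; map; upTo; drop)
open import Data.Bool using (if_then_else_)
open import Data.Nat using (_≡ᵇ_)
open import Relation.Binary.PropositionalEquality using (_≡_)

-- sawtooth function ((x)) = x - ⌊x⌋ - 1/2 if x ∉ ℤ, and 0 if x ∈ ℤ
-- (a rational x is an integer iff its reduced denominator is 1)
saw : ℚ → ℚ
saw x = if (↧ₙ x) ≡ᵇ 1 then 0ℚ else ((x - (floor x ℚ./ 1)) - ½)

dedekind : (a b : ℕ) → .{{_ : NonZero b}} → ℚ
dedekind a b = foldr _+_ 0ℚ (map (λ k → saw ((+ k) ℚ./ b) * saw ((+ (a ℕ.* k)) ℚ./ b)) (drop 1 (upTo b)))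

infix 4 _≡[mod_]_
_≡[mod_]_ : ℕ → (b : ℕ) → .{{_ : NonZero b}} → ℕ → Set
x ≡[mod b ] y = x % b ≡ y % b

module Submission where

-- For b ∤ n the value 2b·((n/b)) is the integer 2(n mod b) − b, so 4b²·s(a,b) + b²
-- equals D(a) = Σ_{0≤k<b} (2k − b)(2(ak mod b) − b), and s(a₁,b) = s(a₂,b) iff
-- D(a₁) = D(a₂) (dedekind-≡⇔).  D(a) depends only on a mod b, and D(a) = D(a⁻¹)
-- by the substitution k ↦ ak; this gives the "if" direction.  For "only if",
-- write ak = r + qb; splitting each term of D and reindexing the part in
-- r = ak mod b gives the moment identity (moment-identity)
--   3a·D(a) + 12b²·H(a) = (a² + 1)b(b − 1)(2b − 1) − 3b²(b − 1)(3a − 1) + 3ab³,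
-- where H(a) = Σ_k C(⌊ak/b⌋, 2).  Eliminating D between a₁ and a₂ yields the key
-- identity (a₁ − a₂)(a₁a₂ − 1)(b − 1)(2b − 1) = 3b(b − 1)(a₁ − a₂) + 12b·M.  Then p,
-- coprime to (b − 1)(2b − 1), divides a₁ − a₂ or a₁a₂ − 1, while comparing powers of 2
-- on both sides (possible as e ≤ 3) shows that 2^e divides both; hence b divides one.

open import Defs
open import Data.Bool using (true; false; T)
open import Data.Empty using (⊥; ⊥-elim)
open import Data.Fin as Fin using (Fin; toℕ)
open import Data.Fin.Permutation using (Permutation; permutation)
open import Data.Fin.Properties using (toℕ<n; toℕ-fromℕ<; toℕ-injective; toℕ-inject₁; toℕ-fromℕ)
open import Data.Integer as ℤ using (ℤ; +_; -[1+_])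
open import Data.Integer.Divisibility.Signed
import Data.Integer.DivMod as ℤ
import Data.Integer.Properties as ℤ
open import Data.Integer.Tactic.RingSolver using (solve-∀; solve)
open import Data.List using (_∷_; []; foldr; map; applyUpTo)
open import Data.Nat as ℕ using (ℕ; zero; suc; NonZero; _*_; _^_; _≤_)
open import Data.Nat.Coprimality using (Coprime; coprime-divisor; coprime-Bézout)
import Data.Nat.Coprimality as Coprime
import Data.Nat.Divisibility as ℕ
open import Data.Nat.DivMod using (_%_)
import Data.Nat.DivMod as ℕ
open import Data.Nat.GCD using (gcd; gcd[m,n]∣m; module Bézout)
open import Data.Nat.Primality using (Prime; euclidsLemma; ¬prime[0]; ¬prime[1])
import Data.Nat.Properties as ℕ
open import Data.Nat.Tactic.RingSolver using () renaming (solve-∀ to ℕ-solve-∀)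
open import Data.Product using (_×_; _,_; ∃-syntax; proj₁; proj₂)
open import Data.Rational as ℚ using (ℚ; mkℚ; _/_; ↥_; ↧_; ↧ₙ_; floor; ½)
import Data.Rational.Properties as ℚ
open import Data.Rational.Unnormalised as ℚᵘ using (mkℚᵘ; *≡*)
import Data.Rational.Unnormalised.Properties as ℚᵘ
open import Data.Sum as Sum using (_⊎_; inj₁; inj₂)
open import Data.Unit using (tt)
open import Function.Base using (_∘_)
open import Function.Bundles using (_⇔_; mk⇔; module Equivalence)
open import Relation.Binary.PropositionalEquality
open import Relation.Nullary using (¬_)
open import Algebra.Properties.AbelianGroup ℤ.+-0-abelianGroup using (∙-cancelˡ)
open import Algebra.Properties.Semiring.Sum ℤ.+-*-semiring
  using (sum; sum-cong-≗; sum-permute; sum-init-last; ∑-distrib-+; *-distribˡ-sum)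

fromℚᵘ-+ : ∀ p q → ℚ.fromℚᵘ (p ℚᵘ.+ q) ≡ ℚ.fromℚᵘ p ℚ.+ ℚ.fromℚᵘ q
fromℚᵘ-+ p q = ℚ.toℚᵘ-injective (begin
  ℚ.toℚᵘ (ℚ.fromℚᵘ (p ℚᵘ.+ q))                 ≈⟨ ℚ.toℚᵘ-fromℚᵘ (p ℚᵘ.+ q) ⟩
  p ℚᵘ.+ q                                      ≈⟨ ℚᵘ.+-cong (ℚᵘ.≃-sym (ℚ.toℚᵘ-fromℚᵘ p)) (ℚᵘ.≃-sym (ℚ.toℚᵘ-fromℚᵘ q)) ⟩
  ℚ.toℚᵘ (ℚ.fromℚᵘ p) ℚᵘ.+ ℚ.toℚᵘ (ℚ.fromℚᵘ q)  ≈⟨ ℚᵘ.≃-sym (ℚ.toℚᵘ-homo-+ (ℚ.fromℚᵘ p) (ℚ.fromℚᵘ q)) ⟩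
  ℚ.toℚᵘ (ℚ.fromℚᵘ p ℚ.+ ℚ.fromℚᵘ q)            ∎)
  where open ℚᵘ.≃-Reasoning

fromℚᵘ-* : ∀ p q → ℚ.fromℚᵘ (p ℚᵘ.* q) ≡ ℚ.fromℚᵘ p ℚ.* ℚ.fromℚᵘ q
fromℚᵘ-* p q = ℚ.toℚᵘ-injective (begin
  ℚ.toℚᵘ (ℚ.fromℚᵘ (p ℚᵘ.* q))                 ≈⟨ ℚ.toℚᵘ-fromℚᵘ (p ℚᵘ.* q) ⟩
  p ℚᵘ.* q                                      ≈⟨ ℚᵘ.*-cong (ℚᵘ.≃-sym (ℚ.toℚᵘ-fromℚᵘ p)) (ℚᵘ.≃-sym (ℚ.toℚᵘ-fromℚᵘ q)) ⟩
  ℚ.toℚᵘ (ℚ.fromℚᵘ p) ℚᵘ.* ℚ.toℚᵘ (ℚ.fromℚᵘ q)  ≈⟨ ℚᵘ.≃-sym (ℚ.toℚᵘ-homo-* (ℚ.fromℚᵘ p) (ℚ.fromℚᵘ q)) ⟩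
  ℚ.toℚᵘ (ℚ.fromℚᵘ p ℚ.* ℚ.fromℚᵘ q)            ∎)
  where open ℚᵘ.≃-Reasoning

fromℚᵘ-neg : ∀ p → ℚ.fromℚᵘ (ℚᵘ.- p) ≡ ℚ.- ℚ.fromℚᵘ p
fromℚᵘ-neg p = ℚ.toℚᵘ-injective (begin
  ℚ.toℚᵘ (ℚ.fromℚᵘ (ℚᵘ.- p))   ≈⟨ ℚ.toℚᵘ-fromℚᵘ (ℚᵘ.- p) ⟩
  ℚᵘ.- p                        ≈⟨ ℚᵘ.-‿cong (ℚᵘ.≃-sym (ℚ.toℚᵘ-fromℚᵘ p)) ⟩
  ℚᵘ.- ℚ.toℚᵘ (ℚ.fromℚᵘ p)      ≈⟨ ℚᵘ.≃-sym (ℚ.toℚᵘ-homo‿- (ℚ.fromℚᵘ p)) ⟩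
  ℚ.toℚᵘ (ℚ.- ℚ.fromℚᵘ p)       ∎)
  where open ℚᵘ.≃-Reasoning

frac-+ : ∀ i d j e → i / suc d ℚ.+ j / suc e ≡ (i ℤ.* + suc e ℤ.+ j ℤ.* + suc d) / (suc d ℕ.* suc e)
frac-+ i d j e = sym (fromℚᵘ-+ (mkℚᵘ i d) (mkℚᵘ j e))

frac-* : ∀ i d j e → (i / suc d) ℚ.* (j / suc e) ≡ (i ℤ.* j) / (suc d ℕ.* suc e)
frac-* i d j e = sym (fromℚᵘ-* (mkℚᵘ i d) (mkℚᵘ j e))

frac-neg : ∀ i d → ℚ.- (i / suc d) ≡ ℤ.- i / suc d
frac-neg i d = sym (fromℚᵘ-neg (mkℚᵘ i d))

frac-cross : ∀ i d j e → i ℤ.* + suc e ≡ j ℤ.* + suc d → i / suc d ≡ j / suc e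
frac-cross i d j e eq = ℚ.fromℚᵘ-cong {mkℚᵘ i d} {mkℚᵘ j e} (*≡* eq)

frac-injective : ∀ i j d → i / suc d ≡ j / suc d → i ≡ j
frac-injective i j d eq with ℚ.fromℚᵘ-injective {mkℚᵘ i d} {mkℚᵘ j d} eq
... | *≡* cross = ℤ.*-cancelʳ-≡ i j (+ suc d) cross

frac-+-same : ∀ i j d → i / suc d ℚ.+ j / suc d ≡ (i ℤ.+ j) / suc d
frac-+-same i j d = trans (frac-+ i d j d) (frac-cross (i ℤ.* D ℤ.+ j ℤ.* D) (ℕ.pred (suc d ℕ.* suc d)) (i ℤ.+ j) d (begin
  (i ℤ.* D ℤ.+ j ℤ.* D) ℤ.* D   ≡⟨ distrib i j D ⟩
  (i ℤ.+ j) ℤ.* (D ℤ.* D)       ≡⟨ cong ((i ℤ.+ j) ℤ.*_) (ℤ.pos-* (suc d) (suc d)) ⟨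
  (i ℤ.+ j) ℤ.* + (suc d ℕ.* suc d) ∎))
  where
  open ≡-Reasoning
  D : ℤ
  D = + suc d
  distrib : ∀ i j D → (i ℤ.* D ℤ.+ j ℤ.* D) ℤ.* D ≡ (i ℤ.+ j) ℤ.* (D ℤ.* D)
  distrib = solve-∀

-- The integer 2b·((n/b)) for b ∤ n: twice the residue of n, centred at b.
centred : (b : ℕ) .{{_ : NonZero b}} → ℕ → ℤ
centred b n = + 2 ℤ.* + (n ℕ.% b) ℤ.- + b

saw-nonint : ∀ q → ↧ₙ q ≢ 1 → saw q ≡ (q ℚ.- floor q / 1) ℚ.- ½
saw-nonint q ↧q≢1 with ↧ₙ q ℕ.≡ᵇ 1 in eq
... | true  = ⊥-elim (↧q≢1 (ℕ.≡ᵇ⇒≡ _ _ (subst T (sym eq) tt)))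
... | false = refl

-- If b ∤ n then n/b is not an integer: its reduced denominator b/gcd(n,b) exceeds 1.
↧ₙ-/≢1 : ∀ n b .{{_ : NonZero b}} → ¬ b ℕ.∣ n → ↧ₙ (+ n / b) ≢ 1
↧ₙ-/≢1 n b b∤n ↧≡1 = b∤n (subst (ℕ._∣ n) gcd≡b (gcd[m,n]∣m n b))
  where
  gcd≡b : gcd n b ≡ b
  gcd≡b = ℤ.+-injective (begin
    + gcd n b                   ≡⟨ ℤ.*-identityˡ (+ gcd n b) ⟨
    + 1 ℤ.* + gcd n b           ≡⟨ cong (λ d → + d ℤ.* + gcd n b) ↧≡1 ⟨
    ↧ (+ n / b) ℤ.* + gcd n b   ≡⟨ ℚ.↧-/ (+ n) b ⟩
    + b                         ∎)
    where open ≡-Reasoning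

floor-scaled : ∀ q g n b .{{_ : NonZero b}} → ↥ q ℤ.* + g ≡ + n → ↧ q ℤ.* + g ≡ + b →
               floor q ≡ + (n ℕ./ b)
floor-scaled (mkℚ -[1+ u ] d _) zero    n b _ ↧g≡b = ⊥-elim (ℕ.≢-nonZero⁻¹ b (ℤ.+-injective (trans (sym ↧g≡b) (ℤ.*-zeroʳ (+ suc d)))))
floor-scaled (mkℚ -[1+ u ] d _) (suc g) n b () _
floor-scaled (mkℚ (+ u)    d _) g       n b ↥g≡n ↧g≡b = begin
  + u ℤ./ + suc d                   ≡⟨ ℤ.div-pos-is-/ℕ (+ u) (suc d) ⟩
  + (u ℕ./ suc d)                   ≡⟨ cong +_ (ℕ.m*n/o*n≡m/o u g (suc d)) ⟨
  + (u ℕ.* g ℕ./ (suc d ℕ.* g))     ≡⟨ cong +_ (ℕ./-congʳ dg≡b) ⟩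
  + (u ℕ.* g ℕ./ b)                 ≡⟨ cong (λ x → + (x ℕ./ b)) (ℤ.+-injective (trans (ℤ.pos-* u g) ↥g≡n)) ⟩
  + (n ℕ./ b)                       ∎
  where
  open ≡-Reasoning
  dg≡b : suc d ℕ.* g ≡ b
  dg≡b = ℤ.+-injective (trans (ℤ.pos-* (suc d) g) ↧g≡b)
  instance
    _ : NonZero (suc d ℕ.* g)
    _ = ℕ.≢-nonZero (λ dg≡0 → ℕ.≢-nonZero⁻¹ b (trans (sym dg≡b) dg≡0))

ℤ-division : ∀ {b} .{{_ : NonZero b}} n → + n ≡ + (n ℕ.% b) ℤ.+ + (n ℕ./ b) ℤ.* + b
ℤ-division {b} n = begin
  + n                                     ≡⟨ cong +_ (ℕ.m≡m%n+[m/n]*n n b) ⟩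
  + (n ℕ.% b ℕ.+ n ℕ./ b ℕ.* b)           ≡⟨ ℤ.pos-+ (n ℕ.% b) (n ℕ./ b ℕ.* b) ⟩
  + (n ℕ.% b) ℤ.+ + (n ℕ./ b ℕ.* b)       ≡⟨ cong (ℤ._+_ (+ (n ℕ.% b))) (ℤ.pos-* (n ℕ./ b) b) ⟩
  + (n ℕ.% b) ℤ.+ + (n ℕ./ b) ℤ.* + b     ∎
  where open ≡-Reasoning

saw-/ : ∀ m n → ¬ suc m ℕ.∣ n → saw (+ n / suc m) ≡ centred (suc m) n / (2 ℕ.* suc m)
saw-/ m n b∤n = begin
  saw (+ n / b)                                        ≡⟨ saw-nonint (+ n / b) (↧ₙ-/≢1 n b b∤n) ⟩
  (+ n / b ℚ.- floor (+ n / b) / 1) ℚ.- ½              ≡⟨ cong (λ z → (+ n / b ℚ.- z / 1) ℚ.- ½) floor-n/b ⟩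
  (+ n / b ℚ.- + w / 1) ℚ.- + 1 / 2                    ≡⟨ cong₂ (λ x y → (+ n / b ℚ.+ x) ℚ.+ y) (frac-neg (+ w) 0) (frac-neg (+ 1) 1) ⟩
  (+ n / b ℚ.+ ℤ.- + w / 1) ℚ.+ ℤ.- + 1 / 2            ≡⟨ cong (ℚ._+ ℤ.- + 1 / 2) (frac-+ (+ n) m (ℤ.- + w) 0) ⟩
  N₁ / (b ℕ.* 1) ℚ.+ ℤ.- + 1 / 2                       ≡⟨ frac-+ N₁ (ℕ.pred (b ℕ.* 1)) (ℤ.- + 1) 1 ⟩
  N₂ / (b ℕ.* 1 ℕ.* 2)                                 ≡⟨ frac-cross N₂ (ℕ.pred (b ℕ.* 1 ℕ.* 2)) (centred b n) (ℕ.pred (2 ℕ.* b)) cross ⟩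
  centred b n / (2 ℕ.* b)                              ∎
  where
  open ≡-Reasoning
  b w : ℕ
  b = suc m
  w = n ℕ./ b
  shape : ℤ → ℤ → ℤ
  shape n′ b′ = (n′ ℤ.* + 1 ℤ.+ ℤ.- + w ℤ.* + b) ℤ.* + 2 ℤ.+ ℤ.- + 1 ℤ.* b′
  N₁ N₂ : ℤ
  N₁ = + n ℤ.* + 1 ℤ.+ ℤ.- + w ℤ.* + b
  N₂ = shape (+ n) (+ (b ℕ.* 1))
  floor-n/b : floor (+ n / b) ≡ + w
  floor-n/b = floor-scaled (+ n / b) (gcd n b) n b (ℚ.↥-/ (+ n) b) (ℚ.↧-/ (+ n) b)
  identity : ∀ R W B → (((R ℤ.+ W ℤ.* B) ℤ.* + 1 ℤ.+ ℤ.- W ℤ.* B) ℤ.* + 2 ℤ.+ ℤ.- + 1 ℤ.* (B ℤ.* + 1)) ℤ.* (+ 2 ℤ.* B)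
                     ≡ (+ 2 ℤ.* R ℤ.- B) ℤ.* ((B ℤ.* + 1) ℤ.* + 2)
  identity = solve-∀
  cross : N₂ ℤ.* + (2 ℕ.* b) ≡ centred b n ℤ.* + (b ℕ.* 1 ℕ.* 2)
  cross = begin
    shape (+ n) (+ (b ℕ.* 1)) ℤ.* + (2 ℕ.* b)
      ≡⟨ cong₂ (λ n′ b′ → shape n′ b′ ℤ.* + (2 ℕ.* b)) (ℤ-division n) (ℤ.pos-* b 1) ⟩
    shape (+ (n ℕ.% b) ℤ.+ + w ℤ.* + b) (+ b ℤ.* + 1) ℤ.* + (2 ℕ.* b)
      ≡⟨ cong (shape (+ (n ℕ.% b) ℤ.+ + w ℤ.* + b) (+ b ℤ.* + 1) ℤ.*_) (ℤ.pos-* 2 b) ⟩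
    shape (+ (n ℕ.% b) ℤ.+ + w ℤ.* + b) (+ b ℤ.* + 1) ℤ.* (+ 2 ℤ.* + b)
      ≡⟨ identity (+ (n ℕ.% b)) (+ w) (+ b) ⟩
    centred b n ℤ.* ((+ b ℤ.* + 1) ℤ.* + 2)
      ≡⟨ cong (centred b n ℤ.*_) (trans (cong (ℤ._* + 2) (ℤ.pos-* b 1)) (ℤ.pos-* (b ℕ.* 1) 2)) ⟨
    centred b n ℤ.* + (b ℕ.* 1 ℕ.* 2) ∎

sum-frac : ∀ (f : ℕ → ℚ) (z : ℕ → ℤ) d (h : ℕ → ℕ) n →
           (∀ (i : Fin n) → f (h (toℕ i)) ≡ z (h (toℕ i)) / suc d) →
           foldr ℚ._+_ ℚ.0ℚ (map f (applyUpTo h n)) ≡ sum (λ (i : Fin n) → z (h (toℕ i))) / suc d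
sum-frac f z d h zero    _      = sym (ℚ.0/n≡0 (suc d))
sum-frac f z d h (suc n) f≡z/d = begin
  f (h 0) ℚ.+ foldr ℚ._+_ ℚ.0ℚ (map f (applyUpTo (h ∘ suc) n))
    ≡⟨ cong₂ ℚ._+_ (f≡z/d Fin.zero) (sum-frac f z d (h ∘ suc) n (f≡z/d ∘ Fin.suc)) ⟩
  z (h 0) / suc d ℚ.+ sum (λ (i : Fin n) → z (h (suc (toℕ i)))) / suc d
    ≡⟨ frac-+-same (z (h 0)) _ d ⟩
  sum (λ (i : Fin (suc n)) → z (h (toℕ i))) / suc d ∎
  where open ≡-Reasoning

dedekindTerm : (b : ℕ) .{{_ : NonZero b}} → ℕ → ℕ → ℤ
dedekindTerm b a k = centred b k ℤ.* centred b (a ℕ.* k)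

-- The Dedekind sum with cleared denominators, including the term k = 0:
-- dedekindℤ b a = 4b²·s(a,b) + b².
dedekindℤ : (b : ℕ) .{{_ : NonZero b}} → ℕ → ℤ
dedekindℤ b a = sum (λ (k : Fin b) → dedekindTerm b a (toℕ k))

coprime⇒∤ : ∀ {a b k} → Coprime a b → 0 ℕ.< k → k ℕ.< b → ¬ b ℕ.∣ a ℕ.* k
coprime⇒∤ {k = suc _} a⊥b _ k<b b∣ak = ℕ.<⇒≱ k<b (ℕ.∣⇒≤ (coprime-divisor (Coprime.sym a⊥b) b∣ak))

dedekind-frac : ∀ m a → Coprime a (suc m) →
  dedekind a (suc m) ≡ sum (λ (i : Fin m) → dedekindTerm (suc m) a (suc (toℕ i))) / (2 ℕ.* suc m ℕ.* (2 ℕ.* suc m))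
dedekind-frac m a a⊥b = sum-frac _ (dedekindTerm b a) _ suc m λ i → begin
  saw (+ suc (toℕ i) / b) ℚ.* saw (+ (a ℕ.* suc (toℕ i)) / b)
    ≡⟨ cong₂ ℚ._*_ (saw-/ m (suc (toℕ i)) (coprime⇒∤ (Coprime.1-coprimeTo b) ℕ.z<s (ℕ.s≤s (toℕ<n i)) ∘ ∣-1*))
                   (saw-/ m (a ℕ.* suc (toℕ i)) (coprime⇒∤ a⊥b ℕ.z<s (ℕ.s≤s (toℕ<n i)))) ⟩
  (centred b (suc (toℕ i)) / (2 ℕ.* b)) ℚ.* (centred b (a ℕ.* suc (toℕ i)) / (2 ℕ.* b))
    ≡⟨ frac-* (centred b (suc (toℕ i))) _ (centred b (a ℕ.* suc (toℕ i))) _ ⟩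
  dedekindTerm b a (suc (toℕ i)) / (2 ℕ.* b ℕ.* (2 ℕ.* b)) ∎
  where
  open ≡-Reasoning
  b : ℕ
  b = suc m
  ∣-1* : ∀ {k} → b ℕ.∣ k → b ℕ.∣ 1 ℕ.* k
  ∣-1* {k} = subst (b ℕ.∣_) (sym (ℕ.*-identityˡ k))

-- Equality of Dedekind sums is equality of the integers dedekindℤ, whose terms
-- k = 1, …, b − 1 form the numerator of s(a,b) and whose term k = 0 is b².
dedekind-≡⇔ : ∀ b .{{_ : NonZero b}} {a₁ a₂} → Coprime a₁ b → Coprime a₂ b →
              (dedekind a₁ b ≡ dedekind a₂ b) ⇔ (dedekindℤ b a₁ ≡ dedekindℤ b a₂)
dedekind-≡⇔ (suc m) {a₁} {a₂} a₁⊥b a₂⊥b = mk⇔ sums⇒integers integers⇒sums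
  where
  open ≡-Reasoning
  b D : ℕ
  b = suc m
  D = ℕ.pred (2 ℕ.* b ℕ.* (2 ℕ.* b))
  Σ : ℕ → ℤ
  Σ a = sum (λ (i : Fin m) → dedekindTerm b a (suc (toℕ i)))
  term₀ : dedekindTerm b a₁ 0 ≡ dedekindTerm b a₂ 0
  term₀ = cong (λ x → centred b 0 ℤ.* centred b x) (trans (ℕ.*-zeroʳ a₁) (sym (ℕ.*-zeroʳ a₂)))
  sums⇒integers : dedekind a₁ b ≡ dedekind a₂ b → dedekindℤ b a₁ ≡ dedekindℤ b a₂
  sums⇒integers s≡s = cong₂ ℤ._+_ term₀ (frac-injective (Σ a₁) (Σ a₂) D (begin
    Σ a₁ / suc D     ≡⟨ dedekind-frac m a₁ a₁⊥b ⟨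
    dedekind a₁ b    ≡⟨ s≡s ⟩
    dedekind a₂ b    ≡⟨ dedekind-frac m a₂ a₂⊥b ⟩
    Σ a₂ / suc D     ∎))
  integers⇒sums : dedekindℤ b a₁ ≡ dedekindℤ b a₂ → dedekind a₁ b ≡ dedekind a₂ b
  integers⇒sums D≡D = begin
    dedekind a₁ b    ≡⟨ dedekind-frac m a₁ a₁⊥b ⟩
    Σ a₁ / suc D     ≡⟨ cong (_/ suc D) (∙-cancelˡ (dedekindTerm b a₂ 0) (Σ a₁) (Σ a₂) (trans (cong (ℤ._+ Σ a₁) (sym term₀)) D≡D)) ⟩
    Σ a₂ / suc D     ≡⟨ dedekind-frac m a₂ a₂⊥b ⟨
    dedekind a₂ b    ∎

coprime⇒inverse : ∀ {a b} .{{_ : NonZero b}} → Coprime a b → ∃[ c ] c ℕ.* a ≡[mod b ] 1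
coprime⇒inverse {a} {suc m} a⊥b with coprime-Bézout a⊥b
... | Bézout.+- x y 1+yb≡xa = x , (begin
  x ℕ.* a ℕ.% suc m                ≡⟨ cong (ℕ._% suc m) 1+yb≡xa ⟨
  (1 ℕ.+ y ℕ.* suc m) ℕ.% suc m    ≡⟨ ℕ.[m+kn]%n≡m%n 1 y (suc m) ⟩
  1 ℕ.% suc m                      ∎)
  where open ≡-Reasoning
... | Bézout.-+ x y 1+xa≡yb = m ℕ.* x , (begin
  m ℕ.* x ℕ.* a ℕ.% suc m                          ≡⟨ ℕ.[m+kn]%n≡m%n (m ℕ.* x ℕ.* a) y (suc m) ⟨
  (m ℕ.* x ℕ.* a ℕ.+ y ℕ.* suc m) ℕ.% suc m        ≡⟨ cong (λ t → (m ℕ.* x ℕ.* a ℕ.+ t) ℕ.% suc m) 1+xa≡yb ⟨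
  (m ℕ.* x ℕ.* a ℕ.+ (1 ℕ.+ x ℕ.* a)) ℕ.% suc m    ≡⟨ cong (ℕ._% suc m) (regroup m x a) ⟩
  (1 ℕ.+ x ℕ.* a ℕ.* suc m) ℕ.% suc m              ≡⟨ ℕ.[m+kn]%n≡m%n 1 (x ℕ.* a) (suc m) ⟩
  1 ℕ.% suc m                                      ∎)
  where
  open ≡-Reasoning
  regroup : ∀ m x a → m ℕ.* x ℕ.* a ℕ.+ (1 ℕ.+ x ℕ.* a) ≡ 1 ℕ.+ x ℕ.* a ℕ.* (1 ℕ.+ m)
  regroup = ℕ-solve-∀

inverse-cancel : ∀ {b} .{{_ : NonZero b}} a c → c ℕ.* a ≡[mod b ] 1 → ∀ k → (c ℕ.* (a ℕ.* k ℕ.% b)) ℕ.% b ≡ k ℕ.% b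
inverse-cancel {b} a c ca≡1 k = begin
  (c ℕ.* (a ℕ.* k ℕ.% b)) ℕ.% b                 ≡⟨ ℕ.%-distribˡ-* c (a ℕ.* k ℕ.% b) b ⟩
  (c ℕ.% b ℕ.* (a ℕ.* k ℕ.% b ℕ.% b)) ℕ.% b      ≡⟨ cong (λ x → (c ℕ.% b ℕ.* x) ℕ.% b) (ℕ.m%n%n≡m%n (a ℕ.* k) b) ⟩
  (c ℕ.% b ℕ.* (a ℕ.* k ℕ.% b)) ℕ.% b            ≡⟨ ℕ.%-distribˡ-* c (a ℕ.* k) b ⟨
  (c ℕ.* (a ℕ.* k)) ℕ.% b                       ≡⟨ cong (ℕ._% b) (ℕ.*-assoc c a k) ⟨
  (c ℕ.* a ℕ.* k) ℕ.% b                         ≡⟨ ℕ.%-distribˡ-* (c ℕ.* a) k b ⟩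
  (c ℕ.* a ℕ.% b ℕ.* (k ℕ.% b)) ℕ.% b            ≡⟨ cong (λ x → (x ℕ.* (k ℕ.% b)) ℕ.% b) ca≡1 ⟩
  (1 ℕ.% b ℕ.* (k ℕ.% b)) ℕ.% b                  ≡⟨ ℕ.%-distribˡ-* 1 k b ⟨
  (1 ℕ.* k) ℕ.% b                               ≡⟨ cong (ℕ._% b) (ℕ.*-identityˡ k) ⟩
  k ℕ.% b                                       ∎
  where open ≡-Reasoning

mulMod : (b : ℕ) .{{_ : NonZero b}} → ℕ → Fin b → Fin b
mulMod b a k = Fin.fromℕ< (ℕ.m%n<n (a ℕ.* toℕ k) b)

mulMod-inverse : ∀ {b} .{{_ : NonZero b}} a c → c ℕ.* a ≡[mod b ] 1 → ∀ k → mulMod b c (mulMod b a k) ≡ k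
mulMod-inverse {b} a c ca≡1 k = toℕ-injective (begin
  toℕ (mulMod b c (mulMod b a k))       ≡⟨ toℕ-fromℕ< _ ⟩
  c ℕ.* toℕ (mulMod b a k) ℕ.% b        ≡⟨ cong (λ x → c ℕ.* x ℕ.% b) (toℕ-fromℕ< _) ⟩
  c ℕ.* (a ℕ.* toℕ k ℕ.% b) ℕ.% b       ≡⟨ inverse-cancel a c ca≡1 (toℕ k) ⟩
  toℕ k ℕ.% b                          ≡⟨ ℕ.m<n⇒m%n≡m (toℕ<n k) ⟩
  toℕ k                                ∎)
  where open ≡-Reasoning

-- Multiplication by a unit permutes the residues, so a sum over all residues
-- k mod b may be reindexed by k ↦ a·k mod b.
sum-reindex : ∀ {b} .{{_ : NonZero b}} a c → c ℕ.* a ≡[mod b ] 1 → (g : ℕ → ℤ) →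
              sum (λ (k : Fin b) → g (toℕ k)) ≡ sum (λ (k : Fin b) → g (a ℕ.* toℕ k ℕ.% b))
sum-reindex {b} a c ca≡1 g = trans (sum-permute (g ∘ toℕ) π) (sum-cong-≗ {b} (λ k → cong g (toℕ-fromℕ< _)))
  where
  ac≡1 : a ℕ.* c ≡[mod b ] 1
  ac≡1 = trans (cong (ℕ._% b) (ℕ.*-comm a c)) ca≡1
  π : Permutation b b
  π = permutation (mulMod b a) (mulMod b c) (mulMod-inverse c a ac≡1) (mulMod-inverse a c ca≡1)

centred-mod : ∀ {b} .{{_ : NonZero b}} {m n} → m ≡[mod b ] n → centred b m ≡ centred b n
centred-mod {b} m≡n = cong (λ r → + 2 ℤ.* + r ℤ.- + b) m≡n

dedekindℤ-mod : ∀ {b} .{{_ : NonZero b}} {a₁ a₂} → a₁ ≡[mod b ] a₂ → dedekindℤ b a₁ ≡ dedekindℤ b a₂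
dedekindℤ-mod {b} {a₁} {a₂} a₁≡a₂ = sum-cong-≗ {b} λ k → cong (centred b (toℕ k) ℤ.*_) (centred-mod (begin
  a₁ ℕ.* toℕ k ℕ.% b                      ≡⟨ ℕ.%-distribˡ-* a₁ (toℕ k) b ⟩
  (a₁ ℕ.% b ℕ.* (toℕ k ℕ.% b)) ℕ.% b      ≡⟨ cong (λ x → (x ℕ.* (toℕ k ℕ.% b)) ℕ.% b) a₁≡a₂ ⟩
  (a₂ ℕ.% b ℕ.* (toℕ k ℕ.% b)) ℕ.% b      ≡⟨ ℕ.%-distribˡ-* a₂ (toℕ k) b ⟨
  a₂ ℕ.* toℕ k ℕ.% b                      ∎))
  where open ≡-Reasoning

-- A multiplier and its inverse have the same Dedekind sum: substitute k ↦ a·k.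
dedekindℤ-inverse : ∀ {b} .{{_ : NonZero b}} a c → c ℕ.* a ≡[mod b ] 1 → dedekindℤ b a ≡ dedekindℤ b c
dedekindℤ-inverse {b} a c ca≡1 = begin
  sum (λ (k : Fin b) → centred b (toℕ k) ℤ.* centred b (a ℕ.* toℕ k))
    ≡⟨ sum-cong-≗ {b} (λ k → cong₂ ℤ._*_ (sym (c[ak]≡k (toℕ k))) (centred-mod (sym (ℕ.m%n%n≡m%n _ b)))) ⟩
  sum (λ (k : Fin b) → g (a ℕ.* toℕ k ℕ.% b))
    ≡⟨ sum-reindex a c ca≡1 g ⟨
  sum (λ (k : Fin b) → g (toℕ k))
    ≡⟨ sum-cong-≗ {b} (λ k → ℤ.*-comm (centred b (c ℕ.* toℕ k)) (centred b (toℕ k))) ⟩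
  sum (λ (k : Fin b) → centred b (toℕ k) ℤ.* centred b (c ℕ.* toℕ k)) ∎
  where
  open ≡-Reasoning
  g : ℕ → ℤ
  g x = centred b (c ℕ.* x) ℤ.* centred b x
  c[ak]≡k : ∀ k → centred b (c ℕ.* (a ℕ.* k ℕ.% b)) ≡ centred b k
  c[ak]≡k k = centred-mod (inverse-cancel a c ca≡1 k)

power-sum : ∀ n (x y z : ℤ) →
  sum (λ (k : Fin n) → + 6 ℤ.* x ℤ.* (+ toℕ k ℤ.* + toℕ k) ℤ.+ + 2 ℤ.* y ℤ.* + toℕ k ℤ.+ z)
    ≡ x ℤ.* + n ℤ.* (+ n ℤ.- + 1) ℤ.* (+ 2 ℤ.* + n ℤ.- + 1) ℤ.+ y ℤ.* + n ℤ.* (+ n ℤ.- + 1) ℤ.+ z ℤ.* + n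
power-sum zero    x y z = solve (x ∷ y ∷ z ∷ [])
power-sum (suc n) x y z = begin
  sum {suc n} (p ∘ toℕ)                    ≡⟨ sum-init-last {n} (p ∘ toℕ) ⟩
  sum {n} (p ∘ toℕ ∘ Fin.inject₁) ℤ.+ p (toℕ (Fin.fromℕ n))
    ≡⟨ cong₂ ℤ._+_ (sum-cong-≗ {n} (cong p ∘ toℕ-inject₁)) (cong p (toℕ-fromℕ n)) ⟩
  sum {n} (p ∘ toℕ) ℤ.+ p n                ≡⟨ cong (ℤ._+ p n) (power-sum n x y z) ⟩
  closed (+ n) ℤ.+ p n                     ≡⟨ step x y z (+ n) ⟩
  closed (+ 1 ℤ.+ + n)                     ∎
  where
  open ≡-Reasoning
  p : ℕ → ℤ
  p k = + 6 ℤ.* x ℤ.* (+ k ℤ.* + k) ℤ.+ + 2 ℤ.* y ℤ.* + k ℤ.+ z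
  closed : ℤ → ℤ
  closed N = x ℤ.* N ℤ.* (N ℤ.- + 1) ℤ.* (+ 2 ℤ.* N ℤ.- + 1) ℤ.+ y ℤ.* N ℤ.* (N ℤ.- + 1) ℤ.+ z ℤ.* N
  step : ∀ x y z N → x ℤ.* N ℤ.* (N ℤ.- + 1) ℤ.* (+ 2 ℤ.* N ℤ.- + 1) ℤ.+ y ℤ.* N ℤ.* (N ℤ.- + 1) ℤ.+ z ℤ.* N
                     ℤ.+ (+ 6 ℤ.* x ℤ.* (N ℤ.* N) ℤ.+ + 2 ℤ.* y ℤ.* N ℤ.+ z)
                   ≡ x ℤ.* (+ 1 ℤ.+ N) ℤ.* ((+ 1 ℤ.+ N) ℤ.- + 1) ℤ.* (+ 2 ℤ.* (+ 1 ℤ.+ N) ℤ.- + 1)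
                     ℤ.+ y ℤ.* (+ 1 ℤ.+ N) ℤ.* ((+ 1 ℤ.+ N) ℤ.- + 1) ℤ.+ z ℤ.* (+ 1 ℤ.+ N)
  step = solve-∀

triangle : ℕ → ℕ
triangle zero    = 0
triangle (suc q) = triangle q ℕ.+ q

triangle-double : ∀ q → + 2 ℤ.* + triangle q ≡ + q ℤ.* + q ℤ.- + q
triangle-double zero    = refl
triangle-double (suc q) = trans (cong (+ 2 ℤ.*_) (ℤ.pos-+ (triangle q) q)) (step (+ triangle q) (+ q) (triangle-double q))
  where
  step : ∀ T Q → + 2 ℤ.* T ≡ Q ℤ.* Q ℤ.- Q → + 2 ℤ.* (T ℤ.+ Q) ≡ (+ 1 ℤ.+ Q) ℤ.* (+ 1 ℤ.+ Q) ℤ.- (+ 1 ℤ.+ Q)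
  step T Q 2T≡Q²-Q = begin
    + 2 ℤ.* (T ℤ.+ Q)                   ≡⟨ solve (T ∷ Q ∷ []) ⟩
    + 2 ℤ.* T ℤ.+ + 2 ℤ.* Q             ≡⟨ cong (ℤ._+ + 2 ℤ.* Q) 2T≡Q²-Q ⟩
    Q ℤ.* Q ℤ.- Q ℤ.+ + 2 ℤ.* Q         ≡⟨ solve (Q ∷ []) ⟩
    (+ 1 ℤ.+ Q) ℤ.* (+ 1 ℤ.+ Q) ℤ.- (+ 1 ℤ.+ Q) ∎
    where open ≡-Reasoning

-- The two halves into which a term of the moment identity splits: a polynomial
-- in k and a polynomial in r (with parameters a and b).
kPart rPart : ℤ → ℤ → ℤ → ℤ
kPart A B K = + 6 ℤ.* (A ℤ.* A) ℤ.* (K ℤ.* K) ℤ.- + 12 ℤ.* A ℤ.* B ℤ.* K ℤ.+ + 3 ℤ.* A ℤ.* (B ℤ.* B)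
rPart A B R = + 6 ℤ.* (R ℤ.* R) ℤ.+ + 6 ℤ.* B ℤ.* (+ 1 ℤ.- A) ℤ.* R

moment-term : ∀ A B K R Q P → R ℤ.+ Q ℤ.* B ≡ A ℤ.* K → + 2 ℤ.* P ≡ Q ℤ.* Q ℤ.- Q →
  + 3 ℤ.* A ℤ.* ((+ 2 ℤ.* K ℤ.- B) ℤ.* (+ 2 ℤ.* R ℤ.- B)) ℤ.+ + 12 ℤ.* (B ℤ.* B) ℤ.* P ≡ kPart A B K ℤ.+ rPart A B R
moment-term A B K R Q P r+qb≡ak 2p≡q²-q = begin
  + 3 ℤ.* A ℤ.* ((+ 2 ℤ.* K ℤ.- B) ℤ.* (+ 2 ℤ.* R ℤ.- B)) ℤ.+ + 12 ℤ.* (B ℤ.* B) ℤ.* P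
    ≡⟨ solve (A ∷ B ∷ K ∷ R ∷ P ∷ []) ⟩
  + 3 ℤ.* A ℤ.* ((+ 2 ℤ.* K ℤ.- B) ℤ.* (+ 2 ℤ.* R ℤ.- B)) ℤ.+ + 6 ℤ.* (B ℤ.* B) ℤ.* (+ 2 ℤ.* P)
    ≡⟨ cong₂ (λ r t → + 3 ℤ.* A ℤ.* ((+ 2 ℤ.* K ℤ.- B) ℤ.* (+ 2 ℤ.* r ℤ.- B)) ℤ.+ + 6 ℤ.* (B ℤ.* B) ℤ.* t) r≡ak-qb 2p≡q²-q ⟩
  + 3 ℤ.* A ℤ.* ((+ 2 ℤ.* K ℤ.- B) ℤ.* (+ 2 ℤ.* (A ℤ.* K ℤ.- Q ℤ.* B) ℤ.- B)) ℤ.+ + 6 ℤ.* (B ℤ.* B) ℤ.* (Q ℤ.* Q ℤ.- Q)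
    ≡⟨ solve (A ∷ B ∷ K ∷ Q ∷ []) ⟩
  (+ 6 ℤ.* (A ℤ.* A) ℤ.* (K ℤ.* K) ℤ.- + 12 ℤ.* A ℤ.* B ℤ.* K ℤ.+ + 3 ℤ.* A ℤ.* (B ℤ.* B))
    ℤ.+ (+ 6 ℤ.* ((A ℤ.* K ℤ.- Q ℤ.* B) ℤ.* (A ℤ.* K ℤ.- Q ℤ.* B)) ℤ.+ + 6 ℤ.* B ℤ.* (+ 1 ℤ.- A) ℤ.* (A ℤ.* K ℤ.- Q ℤ.* B))
    ≡⟨ cong (λ r → kPart A B K ℤ.+ rPart A B r) r≡ak-qb ⟨
  kPart A B K ℤ.+ rPart A B R ∎
  where
  open ≡-Reasoning
  r≡ak-qb : R ≡ A ℤ.* K ℤ.- Q ℤ.* B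
  r≡ak-qb = begin
    R                         ≡⟨ solve (R ∷ Q ∷ B ∷ []) ⟩
    R ℤ.+ Q ℤ.* B ℤ.- Q ℤ.* B  ≡⟨ cong (ℤ._- Q ℤ.* B) r+qb≡ak ⟩
    A ℤ.* K ℤ.- Q ℤ.* B        ∎

-- H(a) = Σ_{k<b} triangle ⌊ak/b⌋, the part of Σ ⌊ak/b⌋² not already in Σ ⌊ak/b⌋.
quotientPairs : (b : ℕ) .{{_ : NonZero b}} → ℕ → ℤ
quotientPairs b a = sum (λ (k : Fin b) → + triangle (a ℕ.* toℕ k ℕ./ b))

moment-term-at : ∀ {b} .{{_ : NonZero b}} a {k} → k ℕ.< b →
  + 3 ℤ.* + a ℤ.* dedekindTerm b a k ℤ.+ + 12 ℤ.* (+ b ℤ.* + b) ℤ.* + triangle (a ℕ.* k ℕ./ b)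
    ≡ kPart (+ a) (+ b) (+ k) ℤ.+ rPart (+ a) (+ b) (+ (a ℕ.* k ℕ.% b))
moment-term-at {b} a {k} k<b = begin
  + 3 ℤ.* + a ℤ.* (centred b k ℤ.* centred b (a ℕ.* k)) ℤ.+ + 12 ℤ.* (+ b ℤ.* + b) ℤ.* P
    ≡⟨ cong (λ j → + 3 ℤ.* + a ℤ.* ((+ 2 ℤ.* + j ℤ.- + b) ℤ.* centred b (a ℕ.* k)) ℤ.+ + 12 ℤ.* (+ b ℤ.* + b) ℤ.* P)
            (ℕ.m<n⇒m%n≡m k<b) ⟩
  + 3 ℤ.* + a ℤ.* ((+ 2 ℤ.* + k ℤ.- + b) ℤ.* centred b (a ℕ.* k)) ℤ.+ + 12 ℤ.* (+ b ℤ.* + b) ℤ.* P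
    ≡⟨ moment-term (+ a) (+ b) (+ k) (+ (a ℕ.* k ℕ.% b)) (+ q) P
                   (trans (sym (ℤ-division (a ℕ.* k))) (ℤ.pos-* a k)) (triangle-double q) ⟩
  kPart (+ a) (+ b) (+ k) ℤ.+ rPart (+ a) (+ b) (+ (a ℕ.* k ℕ.% b)) ∎
  where
  open ≡-Reasoning
  q : ℕ
  q = a ℕ.* k ℕ./ b
  P : ℤ
  P = + triangle q

momentValue : ℤ → ℤ → ℤ
momentValue A B = (A ℤ.* A ℤ.+ + 1) ℤ.* B ℤ.* (B ℤ.- + 1) ℤ.* (+ 2 ℤ.* B ℤ.- + 1)
                  ℤ.- + 3 ℤ.* (B ℤ.* B) ℤ.* (B ℤ.- + 1) ℤ.* (+ 3 ℤ.* A ℤ.- + 1)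
                  ℤ.+ + 3 ℤ.* A ℤ.* (B ℤ.* (B ℤ.* B))

-- Split each term by moment-term-at, move the part in r = ak mod b back to k by
-- reindexing, and sum the resulting polynomial in k.
moment-identity : ∀ {b} .{{_ : NonZero b}} a c → c ℕ.* a ≡[mod b ] 1 →
  + 3 ℤ.* + a ℤ.* dedekindℤ b a ℤ.+ + 12 ℤ.* (+ b ℤ.* + b) ℤ.* quotientPairs b a ≡ momentValue (+ a) (+ b)
moment-identity {b} a c ca≡1 = begin
  + 3 ℤ.* A ℤ.* Σ (term ∘ toℕ) ℤ.+ + 12 ℤ.* (B ℤ.* B) ℤ.* Σ (pairs ∘ toℕ)
    ≡⟨ cong₂ ℤ._+_ (*-distribˡ-sum {b} (+ 3 ℤ.* A) (term ∘ toℕ)) (*-distribˡ-sum {b} (+ 12 ℤ.* (B ℤ.* B)) (pairs ∘ toℕ)) ⟩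
  Σ (λ k → + 3 ℤ.* A ℤ.* term (toℕ k)) ℤ.+ Σ (λ k → + 12 ℤ.* (B ℤ.* B) ℤ.* pairs (toℕ k))
    ≡⟨ ∑-distrib-+ {b} (λ k → + 3 ℤ.* A ℤ.* term (toℕ k)) (λ k → + 12 ℤ.* (B ℤ.* B) ℤ.* pairs (toℕ k)) ⟨
  Σ (λ k → + 3 ℤ.* A ℤ.* term (toℕ k) ℤ.+ + 12 ℤ.* (B ℤ.* B) ℤ.* pairs (toℕ k))
    ≡⟨ sum-cong-≗ {b} (moment-term-at a ∘ toℕ<n) ⟩
  Σ (λ k → kPart A B (+ toℕ k) ℤ.+ rPart A B (+ (a ℕ.* toℕ k ℕ.% b)))
    ≡⟨ ∑-distrib-+ {b} (λ k → kPart A B (+ toℕ k)) (λ k → rPart A B (+ (a ℕ.* toℕ k ℕ.% b))) ⟩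
  Σ (λ k → kPart A B (+ toℕ k)) ℤ.+ Σ (λ k → rPart A B (+ (a ℕ.* toℕ k ℕ.% b)))
    ≡⟨ cong (ℤ._+_ (Σ (λ k → kPart A B (+ toℕ k)))) (sum-reindex a c ca≡1 (rPart A B ∘ +_)) ⟨
  Σ (λ k → kPart A B (+ toℕ k)) ℤ.+ Σ (λ k → rPart A B (+ toℕ k))
    ≡⟨ ∑-distrib-+ {b} (λ k → kPart A B (+ toℕ k)) (λ k → rPart A B (+ toℕ k)) ⟨
  Σ (λ k → kPart A B (+ toℕ k) ℤ.+ rPart A B (+ toℕ k))
    ≡⟨ sum-cong-≗ {b} (λ k → regroup A B (+ toℕ k)) ⟩
  Σ (λ k → + 6 ℤ.* x ℤ.* (+ toℕ k ℤ.* + toℕ k) ℤ.+ + 2 ℤ.* y ℤ.* + toℕ k ℤ.+ z)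
    ≡⟨ power-sum b x y z ⟩
  x ℤ.* B ℤ.* (B ℤ.- + 1) ℤ.* (+ 2 ℤ.* B ℤ.- + 1) ℤ.+ y ℤ.* B ℤ.* (B ℤ.- + 1) ℤ.+ z ℤ.* B
    ≡⟨ total A B ⟩
  momentValue A B ∎
  where
  open ≡-Reasoning
  Σ : (Fin b → ℤ) → ℤ
  Σ = sum
  A B x y z : ℤ
  A = + a
  B = + b
  x = A ℤ.* A ℤ.+ + 1
  y = + 3 ℤ.* B ℤ.- + 9 ℤ.* A ℤ.* B
  z = + 3 ℤ.* A ℤ.* (B ℤ.* B)
  term pairs : ℕ → ℤ
  term = dedekindTerm b a
  pairs k = + triangle (a ℕ.* k ℕ./ b)
  regroup : ∀ A B K → (+ 6 ℤ.* (A ℤ.* A) ℤ.* (K ℤ.* K) ℤ.- + 12 ℤ.* A ℤ.* B ℤ.* K ℤ.+ + 3 ℤ.* A ℤ.* (B ℤ.* B))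
                      ℤ.+ (+ 6 ℤ.* (K ℤ.* K) ℤ.+ + 6 ℤ.* B ℤ.* (+ 1 ℤ.- A) ℤ.* K)
                    ≡ + 6 ℤ.* (A ℤ.* A ℤ.+ + 1) ℤ.* (K ℤ.* K) ℤ.+ + 2 ℤ.* (+ 3 ℤ.* B ℤ.- + 9 ℤ.* A ℤ.* B) ℤ.* K ℤ.+ + 3 ℤ.* A ℤ.* (B ℤ.* B)
  regroup = solve-∀
  total : ∀ A B → (A ℤ.* A ℤ.+ + 1) ℤ.* B ℤ.* (B ℤ.- + 1) ℤ.* (+ 2 ℤ.* B ℤ.- + 1)
                  ℤ.+ (+ 3 ℤ.* B ℤ.- + 9 ℤ.* A ℤ.* B) ℤ.* B ℤ.* (B ℤ.- + 1) ℤ.+ + 3 ℤ.* A ℤ.* (B ℤ.* B) ℤ.* B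
                ≡ (A ℤ.* A ℤ.+ + 1) ℤ.* B ℤ.* (B ℤ.- + 1) ℤ.* (+ 2 ℤ.* B ℤ.- + 1)
                  ℤ.- + 3 ℤ.* (B ℤ.* B) ℤ.* (B ℤ.- + 1) ℤ.* (+ 3 ℤ.* A ℤ.- + 1)
                  ℤ.+ + 3 ℤ.* A ℤ.* (B ℤ.* (B ℤ.* B))
  total = solve-∀

KeyIdentity : ℤ → ℤ → ℤ → ℤ → Set
KeyIdentity x y B M = x ℤ.* y ℤ.* (B ℤ.- + 1) ℤ.* (+ 2 ℤ.* B ℤ.- + 1) ≡ + 3 ℤ.* B ℤ.* (B ℤ.- + 1) ℤ.* x ℤ.+ + 12 ℤ.* B ℤ.* M

-- Two units with equal Dedekind sums satisfy the key identity: combine their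
-- moment identities to eliminate dedekindℤ, then cancel a factor b.
key-identity : ∀ {b} .{{_ : NonZero b}} a₁ c₁ a₂ c₂ → c₁ ℕ.* a₁ ≡[mod b ] 1 → c₂ ℕ.* a₂ ≡[mod b ] 1 →
               dedekindℤ b a₁ ≡ dedekindℤ b a₂ → ∃[ M ] KeyIdentity (+ a₁ ℤ.- + a₂) (+ a₁ ℤ.* + a₂ ℤ.- + 1) (+ b) M
key-identity {b} a₁ c₁ a₂ c₂ c₁a₁≡1 c₂a₂≡1 D₁≡D₂ = A₂ ℤ.* H₁ ℤ.- A₁ ℤ.* H₂ , ℤ.*-cancelˡ-≡ B _ _ (begin
  B ℤ.* (x ℤ.* y ℤ.* (B ℤ.- + 1) ℤ.* (+ 2 ℤ.* B ℤ.- + 1))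
    ≡⟨ eliminate A₁ A₂ B ⟩
  A₂ ℤ.* momentValue A₁ B ℤ.- A₁ ℤ.* momentValue A₂ B ℤ.+ + 3 ℤ.* (B ℤ.* B) ℤ.* (B ℤ.- + 1) ℤ.* x
    ≡⟨ cong₂ (λ s₁ s₂ → A₂ ℤ.* s₁ ℤ.- A₁ ℤ.* s₂ ℤ.+ + 3 ℤ.* (B ℤ.* B) ℤ.* (B ℤ.- + 1) ℤ.* x)
             (moment-identity a₁ c₁ c₁a₁≡1) (moment-identity a₂ c₂ c₂a₂≡1) ⟨
  A₂ ℤ.* (+ 3 ℤ.* A₁ ℤ.* D₁ ℤ.+ + 12 ℤ.* (B ℤ.* B) ℤ.* H₁) ℤ.- A₁ ℤ.* (+ 3 ℤ.* A₂ ℤ.* D₂ ℤ.+ + 12 ℤ.* (B ℤ.* B) ℤ.* H₂)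
    ℤ.+ + 3 ℤ.* (B ℤ.* B) ℤ.* (B ℤ.- + 1) ℤ.* x
    ≡⟨ cong (λ D → A₂ ℤ.* (+ 3 ℤ.* A₁ ℤ.* D₁ ℤ.+ + 12 ℤ.* (B ℤ.* B) ℤ.* H₁) ℤ.- A₁ ℤ.* (+ 3 ℤ.* A₂ ℤ.* D ℤ.+ + 12 ℤ.* (B ℤ.* B) ℤ.* H₂)
                   ℤ.+ + 3 ℤ.* (B ℤ.* B) ℤ.* (B ℤ.- + 1) ℤ.* x) D₁≡D₂ ⟨
  A₂ ℤ.* (+ 3 ℤ.* A₁ ℤ.* D₁ ℤ.+ + 12 ℤ.* (B ℤ.* B) ℤ.* H₁) ℤ.- A₁ ℤ.* (+ 3 ℤ.* A₂ ℤ.* D₁ ℤ.+ + 12 ℤ.* (B ℤ.* B) ℤ.* H₂)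
    ℤ.+ + 3 ℤ.* (B ℤ.* B) ℤ.* (B ℤ.- + 1) ℤ.* x
    ≡⟨ collect A₁ A₂ B D₁ H₁ H₂ ⟩
  B ℤ.* (+ 3 ℤ.* B ℤ.* (B ℤ.- + 1) ℤ.* x ℤ.+ + 12 ℤ.* B ℤ.* (A₂ ℤ.* H₁ ℤ.- A₁ ℤ.* H₂)) ∎)
  where
  open ≡-Reasoning
  A₁ A₂ B x y D₁ D₂ H₁ H₂ : ℤ
  A₁ = + a₁
  A₂ = + a₂
  B = + b
  x = A₁ ℤ.- A₂
  y = A₁ ℤ.* A₂ ℤ.- + 1
  D₁ = dedekindℤ b a₁
  D₂ = dedekindℤ b a₂
  H₁ = quotientPairs b a₁
  H₂ = quotientPairs b a₂
  eliminate : ∀ A₁ A₂ B →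
    B ℤ.* ((A₁ ℤ.- A₂) ℤ.* (A₁ ℤ.* A₂ ℤ.- + 1) ℤ.* (B ℤ.- + 1) ℤ.* (+ 2 ℤ.* B ℤ.- + 1))
      ≡ A₂ ℤ.* ((A₁ ℤ.* A₁ ℤ.+ + 1) ℤ.* B ℤ.* (B ℤ.- + 1) ℤ.* (+ 2 ℤ.* B ℤ.- + 1)
                ℤ.- + 3 ℤ.* (B ℤ.* B) ℤ.* (B ℤ.- + 1) ℤ.* (+ 3 ℤ.* A₁ ℤ.- + 1) ℤ.+ + 3 ℤ.* A₁ ℤ.* (B ℤ.* (B ℤ.* B)))
        ℤ.- A₁ ℤ.* ((A₂ ℤ.* A₂ ℤ.+ + 1) ℤ.* B ℤ.* (B ℤ.- + 1) ℤ.* (+ 2 ℤ.* B ℤ.- + 1)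
                ℤ.- + 3 ℤ.* (B ℤ.* B) ℤ.* (B ℤ.- + 1) ℤ.* (+ 3 ℤ.* A₂ ℤ.- + 1) ℤ.+ + 3 ℤ.* A₂ ℤ.* (B ℤ.* (B ℤ.* B)))
        ℤ.+ + 3 ℤ.* (B ℤ.* B) ℤ.* (B ℤ.- + 1) ℤ.* (A₁ ℤ.- A₂)
  eliminate = solve-∀
  collect : ∀ A₁ A₂ B D H₁ H₂ →
    A₂ ℤ.* (+ 3 ℤ.* A₁ ℤ.* D ℤ.+ + 12 ℤ.* (B ℤ.* B) ℤ.* H₁) ℤ.- A₁ ℤ.* (+ 3 ℤ.* A₂ ℤ.* D ℤ.+ + 12 ℤ.* (B ℤ.* B) ℤ.* H₂)
      ℤ.+ + 3 ℤ.* (B ℤ.* B) ℤ.* (B ℤ.- + 1) ℤ.* (A₁ ℤ.- A₂)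
      ≡ B ℤ.* (+ 3 ℤ.* B ℤ.* (B ℤ.- + 1) ℤ.* (A₁ ℤ.- A₂) ℤ.+ + 12 ℤ.* B ℤ.* (A₂ ℤ.* H₁ ℤ.- A₁ ℤ.* H₂))
  collect = solve-∀

Odd : ℤ → Set
Odd z = ∃[ k ] z ≡ + 2 ℤ.* k ℤ.+ + 1

parity : ∀ z → + 2 ∣ z ⊎ Odd z
parity z = by-remainder (z ℤ.%ℕ 2) (ℤ.n%ℕd<d z 2) (ℤ.a≡a%ℕn+[a/ℕn]*n z 2)
  where
  q : ℤ
  q = z ℤ./ℕ 2
  by-remainder : ∀ r → r ℕ.< 2 → z ≡ + r ℤ.+ q ℤ.* + 2 → + 2 ∣ z ⊎ Odd z
  by-remainder 0 _ z≡ = inj₁ (divides q (trans z≡ (ℤ.+-identityˡ (q ℤ.* + 2))))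
  by-remainder 1 _ z≡ = inj₂ (q , trans z≡ (trans (ℤ.+-comm (+ 1) (q ℤ.* + 2)) (cong (ℤ._+ + 1) (ℤ.*-comm q (+ 2)))))
  by-remainder (suc (suc _)) (ℕ.s≤s (ℕ.s≤s ())) _

odd⇒∤2 : ∀ {z} → Odd z → ¬ + 2 ∣ z
odd⇒∤2 {z} (k , z≡2k+1) (divides q z≡2q) = ℕ.<⇒≱ (ℕ.s≤s (ℕ.s≤s ℕ.z≤n)) (ℕ.∣⇒≤ (∣⇒∣ᵤ 2∣1))
  where
  2∣1 : + 2 ∣ + 1
  2∣1 = divides (q ℤ.- k) (begin
    + 1                          ≡⟨ solve (k ∷ []) ⟩
    + 2 ℤ.* k ℤ.+ + 1 ℤ.- + 2 ℤ.* k  ≡⟨ cong (ℤ._- + 2 ℤ.* k) (trans (sym z≡2k+1) z≡2q) ⟩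
    q ℤ.* + 2 ℤ.- + 2 ℤ.* k          ≡⟨ solve (q ∷ k ∷ []) ⟩
    (q ℤ.- k) ℤ.* + 2                ∎)
    where open ≡-Reasoning

odd-* : ∀ {x y} → Odd x → Odd y → Odd (x ℤ.* y)
odd-* (k , refl) (l , refl) = + 2 ℤ.* k ℤ.* l ℤ.+ k ℤ.+ l , solve (k ∷ l ∷ [])

odd-2z-1 : ∀ z → Odd (+ 2 ℤ.* z ℤ.- + 1)
odd-2z-1 z = z ℤ.- + 1 , solve (z ∷ [])

odd-+-even : ∀ {x e} → Odd x → + 2 ∣ e → Odd (x ℤ.+ e)
odd-+-even (k , refl) (divides t refl) = k ℤ.+ t , solve (k ∷ t ∷ [])

odd-difference : ∀ {x y} → Odd x → Odd y → + 2 ∣ x ℤ.- y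
odd-difference (k , refl) (l , refl) = divides (k ℤ.- l) (solve (k ∷ l ∷ []))

odd-square : ∀ {a} → Odd a → + 8 ∣ a ℤ.* a ℤ.- + 1
odd-square (k , refl) with parity k
... | inj₁ (divides t refl) = divides (t ℤ.* (+ 2 ℤ.* t ℤ.+ + 1)) (even t)
  where
  even : ∀ t → (+ 2 ℤ.* (t ℤ.* + 2) ℤ.+ + 1) ℤ.* (+ 2 ℤ.* (t ℤ.* + 2) ℤ.+ + 1) ℤ.- + 1 ≡ t ℤ.* (+ 2 ℤ.* t ℤ.+ + 1) ℤ.* + 8
  even = solve-∀
... | inj₂ (t , refl)       = divides ((+ 2 ℤ.* t ℤ.+ + 1) ℤ.* (t ℤ.+ + 1)) (odd t)
  where
  odd : ∀ t → (+ 2 ℤ.* (+ 2 ℤ.* t ℤ.+ + 1) ℤ.+ + 1) ℤ.* (+ 2 ℤ.* (+ 2 ℤ.* t ℤ.+ + 1) ℤ.+ + 1) ℤ.- + 1 ≡ (+ 2 ℤ.* t ℤ.+ + 1) ℤ.* (t ℤ.+ + 1) ℤ.* + 8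
  odd = solve-∀

coprime⇒odd : ∀ {a b} → Coprime a b → 2 ℕ.∣ b → Odd (+ a)
coprime⇒odd {a} a⊥b 2∣b with parity (+ a)
... | inj₂ odd = odd
... | inj₁ 2∣a with a⊥b (∣⇒∣ᵤ 2∣a , 2∣b)
...   | ()

-- 2-adic obstruction.  If x = t·u and y = t·v with u, v odd, t ∣ 4 and 2t ∣ b,
-- then the key identity fails: its left side is t²·(odd) while its right side
-- is divisible by 2t².
no-half-power : ∀ T .{{_ : ℤ.NonZero T}} {s x y B M u v β} → T ℤ.* s ≡ + 4 → x ≡ T ℤ.* u → y ≡ T ℤ.* v →
                B ≡ β ℤ.* (+ 2 ℤ.* T) → Odd u → Odd v → ¬ KeyIdentity x y B M
no-half-power T {s} {B = B} {M} {u} {v} {β} ts≡4 refl refl B≡ odd-u odd-v key =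
  odd⇒∤2 odd-lhs (divides (+ 3 ℤ.* β ℤ.* (B ℤ.- + 1) ℤ.* u ℤ.+ + 3 ℤ.* s ℤ.* β ℤ.* M)
                  (ℤ.*-cancelˡ-≡ T _ _ (ℤ.*-cancelˡ-≡ T _ _ t²lhs≡t²rhs)))
  where
  open ≡-Reasoning
  odd-lhs : Odd (u ℤ.* v ℤ.* (B ℤ.- + 1) ℤ.* (+ 2 ℤ.* B ℤ.- + 1))
  odd-lhs = odd-* (odd-* (odd-* odd-u odd-v) (subst Odd B-1 (odd-2z-1 (β ℤ.* T)))) (odd-2z-1 B)
    where
    B-1 : + 2 ℤ.* (β ℤ.* T) ℤ.- + 1 ≡ B ℤ.- + 1
    B-1 = begin
      + 2 ℤ.* (β ℤ.* T) ℤ.- + 1   ≡⟨ solve (β ∷ T ∷ []) ⟩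
      β ℤ.* (+ 2 ℤ.* T) ℤ.- + 1   ≡⟨ cong (ℤ._- + 1) B≡ ⟨
      B ℤ.- + 1                   ∎
  t²lhs≡t²rhs : T ℤ.* (T ℤ.* (u ℤ.* v ℤ.* (B ℤ.- + 1) ℤ.* (+ 2 ℤ.* B ℤ.- + 1)))
              ≡ T ℤ.* (T ℤ.* ((+ 3 ℤ.* β ℤ.* (B ℤ.- + 1) ℤ.* u ℤ.+ + 3 ℤ.* s ℤ.* β ℤ.* M) ℤ.* + 2))
  t²lhs≡t²rhs = begin
    T ℤ.* (T ℤ.* (u ℤ.* v ℤ.* (B ℤ.- + 1) ℤ.* (+ 2 ℤ.* B ℤ.- + 1)))
      ≡⟨ solve (T ∷ u ∷ v ∷ B ∷ []) ⟩
    T ℤ.* u ℤ.* (T ℤ.* v) ℤ.* (B ℤ.- + 1) ℤ.* (+ 2 ℤ.* B ℤ.- + 1)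
      ≡⟨ key ⟩
    + 3 ℤ.* B ℤ.* (B ℤ.- + 1) ℤ.* (T ℤ.* u) ℤ.+ + 12 ℤ.* B ℤ.* M
      ≡⟨ cong (λ B′ → + 3 ℤ.* B′ ℤ.* (B ℤ.- + 1) ℤ.* (T ℤ.* u) ℤ.+ + 12 ℤ.* B′ ℤ.* M) B≡ ⟩
    + 3 ℤ.* (β ℤ.* (+ 2 ℤ.* T)) ℤ.* (B ℤ.- + 1) ℤ.* (T ℤ.* u) ℤ.+ + 12 ℤ.* (β ℤ.* (+ 2 ℤ.* T)) ℤ.* M
      ≡⟨ solve (β ∷ T ∷ B ∷ u ∷ M ∷ []) ⟩
    T ℤ.* (T ℤ.* (+ 6 ℤ.* β ℤ.* (B ℤ.- + 1) ℤ.* u)) ℤ.+ + 6 ℤ.* + 4 ℤ.* (T ℤ.* β ℤ.* M)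
      ≡⟨ cong (λ f → T ℤ.* (T ℤ.* (+ 6 ℤ.* β ℤ.* (B ℤ.- + 1) ℤ.* u)) ℤ.+ + 6 ℤ.* f ℤ.* (T ℤ.* β ℤ.* M)) ts≡4 ⟨
    T ℤ.* (T ℤ.* (+ 6 ℤ.* β ℤ.* (B ℤ.- + 1) ℤ.* u)) ℤ.+ + 6 ℤ.* (T ℤ.* s) ℤ.* (T ℤ.* β ℤ.* M)
      ≡⟨ solve (T ∷ β ∷ B ∷ u ∷ s ∷ M ∷ []) ⟩
    T ℤ.* (T ℤ.* ((+ 3 ℤ.* β ℤ.* (B ℤ.- + 1) ℤ.* u ℤ.+ + 3 ℤ.* s ℤ.* β ℤ.* M) ℤ.* + 2)) ∎

-- Write y = x·a + (a² − 1) with a odd, so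
-- y ≡ x·a (mod 8).  If t ∣ x, t ∣ 4 and 2t ∣ b, then already 2t ∣ x: otherwise
-- x = t·(odd) and y = t·(odd), which no-half-power excludes.
two-adic-step : ∀ T .{{_ : ℤ.NonZero T}} {s a x y B M} → T ℤ.* s ≡ + 4 → Odd a →
                y ≡ x ℤ.* a ℤ.+ (a ℤ.* a ℤ.- + 1) → T ∣ x → + 2 ℤ.* T ∣ B → KeyIdentity x y B M →
                + 2 ℤ.* T ∣ x
two-adic-step T {s} {a} {x} {y} ts≡4 odd-a y≡ (divides w x≡wT) (divides β B≡) key with parity w
... | inj₁ (divides v w≡2v) = divides v (begin
  x                    ≡⟨ x≡wT ⟩
  w ℤ.* T              ≡⟨ cong (ℤ._* T) w≡2v ⟩
  v ℤ.* + 2 ℤ.* T      ≡⟨ ℤ.*-assoc v (+ 2) T ⟩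
  v ℤ.* (+ 2 ℤ.* T)    ∎)
  where open ≡-Reasoning
... | inj₂ odd-w with odd-square odd-a
...   | divides c a²-1≡8c =
  ⊥-elim (no-half-power T {β = β} ts≡4 (trans x≡wT (ℤ.*-comm w T)) y≡T[wa+2sc] B≡ odd-w
                        (odd-+-even (odd-* odd-w odd-a) (divides (s ℤ.* c) (ℤ.*-comm (+ 2) (s ℤ.* c)))) key)
  where
  open ≡-Reasoning
  y≡T[wa+2sc] : y ≡ T ℤ.* (w ℤ.* a ℤ.+ + 2 ℤ.* (s ℤ.* c))
  y≡T[wa+2sc] = begin
    y                                          ≡⟨ y≡ ⟩
    x ℤ.* a ℤ.+ (a ℤ.* a ℤ.- + 1)              ≡⟨ cong₂ (λ x′ r → x′ ℤ.* a ℤ.+ r) x≡wT a²-1≡8c ⟩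
    w ℤ.* T ℤ.* a ℤ.+ c ℤ.* + 8                ≡⟨ solve (w ∷ T ∷ a ∷ c ∷ []) ⟩
    T ℤ.* (w ℤ.* a) ℤ.+ + 2 ℤ.* (+ 4) ℤ.* c    ≡⟨ cong (λ f → T ℤ.* (w ℤ.* a) ℤ.+ + 2 ℤ.* f ℤ.* c) ts≡4 ⟨
    T ℤ.* (w ℤ.* a) ℤ.+ + 2 ℤ.* (T ℤ.* s) ℤ.* c ≡⟨ solve (T ∷ w ∷ a ∷ s ∷ c ∷ []) ⟩
    T ℤ.* (w ℤ.* a ℤ.+ + 2 ℤ.* (s ℤ.* c))      ∎

2^e∣8 : ∀ e → e ℕ.≤ 3 → + (2 ^ e) ∣ + 8
2^e∣8 0 _ = divides (+ 8) refl
2^e∣8 1 _ = divides (+ 4) refl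
2^e∣8 2 _ = divides (+ 2) refl
2^e∣8 3 _ = divides (+ 1) refl
2^e∣8 (suc (suc (suc (suc _)))) (ℕ.s≤s (ℕ.s≤s (ℕ.s≤s ())))

-- The 2-part of the theorem: for e ≤ 3, odd a₁, a₂ and 2^e ∣ b, the key identity
-- forces 2^e to divide both a₁ − a₂ and a₁a₂ − 1.  For a₁ − a₂ iterate
-- two-adic-step from 2 ∣ a₁ − a₂; then a₁a₂ − 1 ≡ (a₁ − a₂)·a₂ (mod 8).
two-adic : ∀ e {A₁ A₂ B M} → e ℕ.≤ 3 → Odd A₁ → Odd A₂ → + (2 ^ e) ∣ B →
           KeyIdentity (A₁ ℤ.- A₂) (A₁ ℤ.* A₂ ℤ.- + 1) B M →
           + (2 ^ e) ∣ A₁ ℤ.- A₂ × + (2 ^ e) ∣ A₁ ℤ.* A₂ ℤ.- + 1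
two-adic e {A₁} {A₂} {B} e≤3 odd₁ odd₂ 2^e∣B key = 2^e∣x e e≤3 2^e∣B , 2^e∣y
  where
  y≡ : A₁ ℤ.* A₂ ℤ.- + 1 ≡ (A₁ ℤ.- A₂) ℤ.* A₂ ℤ.+ (A₂ ℤ.* A₂ ℤ.- + 1)
  y≡ = solve (A₁ ∷ A₂ ∷ [])
  2∣x : + 2 ∣ A₁ ℤ.- A₂
  2∣x = odd-difference odd₁ odd₂
  2^e∣x : ∀ e → e ℕ.≤ 3 → + (2 ^ e) ∣ B → + (2 ^ e) ∣ A₁ ℤ.- A₂
  2^e∣x 0 _ _   = ∣ᵤ⇒∣ (ℕ.1∣ _)
  2^e∣x 1 _ _   = 2∣x
  2^e∣x 2 _ 4∣B = two-adic-step (+ 2) {s = + 2} refl odd₂ y≡ 2∣x 4∣B key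
  2^e∣x 3 _ 8∣B = two-adic-step (+ 4) {s = + 1} refl odd₂ y≡ (two-adic-step (+ 2) {s = + 2} refl odd₂ y≡ 2∣x (∣-trans (divides (+ 2) refl) 8∣B) key) 8∣B key
  2^e∣x (suc (suc (suc (suc _)))) (ℕ.s≤s (ℕ.s≤s (ℕ.s≤s ()))) _
  2^e∣y : + (2 ^ e) ∣ A₁ ℤ.* A₂ ℤ.- + 1
  2^e∣y = subst (+ (2 ^ e) ∣_) (sym y≡) (∣m∣n⇒∣m+n (∣m⇒∣m*n A₂ (2^e∣x e e≤3 2^e∣B)) (∣-trans (2^e∣8 e e≤3) (odd-square odd₂)))

euclid : ∀ {p i j} → Prime p → + p ∣ i ℤ.* j → + p ∣ i ⊎ + p ∣ j
euclid {p} {i} {j} p-prime p∣ij with euclidsLemma ℤ.∣ i ∣ ℤ.∣ j ∣ p-prime (subst (p ℕ.∣_) (ℤ.abs-* i j) (∣⇒∣ᵤ p∣ij))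
... | inj₁ p∣i = inj₁ (∣ᵤ⇒∣ p∣i)
... | inj₂ p∣j = inj₂ (∣ᵤ⇒∣ p∣j)

prime∤z-1 : ∀ {p z} → Prime p → + p ∣ z → ¬ + p ∣ z ℤ.- + 1
prime∤z-1 {p} {z} p-prime p∣z p∣z-1 = ¬prime[1] (subst Prime (ℕ.∣1⇒≡1 (∣⇒∣ᵤ p∣1)) p-prime)
  where
  z-[z-1]≡1 : z ℤ.- (z ℤ.- + 1) ≡ + 1
  z-[z-1]≡1 = solve (z ∷ [])
  p∣1 : + p ∣ + 1
  p∣1 = subst (+ p ∣_) z-[z-1]≡1 (∣m∣n⇒∣m-n p∣z p∣z-1)

-- The odd part: a prime p dividing b divides a₁ − a₂ or a₁a₂ − 1, since it
-- divides the right side of the key identity but neither b − 1 nor 2b − 1.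
prime-part : ∀ {p x y B M} → Prime p → + p ∣ B → KeyIdentity x y B M → + p ∣ x ⊎ + p ∣ y
prime-part {p} {x} {y} {B} {M} p-prime p∣B key
  with euclid p-prime (subst (+ p ∣_) (sym key) (∣m∣n⇒∣m+n (∣m⇒∣m*n x (∣m⇒∣m*n (B ℤ.- + 1) (∣n⇒∣m*n (+ 3) p∣B)))
                                                          (∣m⇒∣m*n M (∣n⇒∣m*n (+ 12) p∣B))))
... | inj₂ p∣2B-1 = ⊥-elim (prime∤z-1 p-prime (∣n⇒∣m*n (+ 2) p∣B) p∣2B-1)
... | inj₁ p∣xy[B-1] with euclid p-prime p∣xy[B-1]
...   | inj₂ p∣B-1 = ⊥-elim (prime∤z-1 p-prime p∣B p∣B-1)
...   | inj₁ p∣xy  = euclid p-prime p∣xy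

odd-prime∤2^ : ∀ {p} e → Prime p → p ℕ.% 2 ≡ 1 → ¬ p ℕ.∣ 2 ^ e
odd-prime∤2^ zero    p-prime _   p∣1 = ¬prime[1] (subst Prime (ℕ.∣1⇒≡1 p∣1) p-prime)
odd-prime∤2^ (suc e) p-prime odd p∣2^[1+e] with euclidsLemma 2 (2 ^ e) p-prime p∣2^[1+e]
... | inj₂ p∣2^e = odd-prime∤2^ e p-prime odd p∣2^e
... | inj₁ p∣2   = not-2 _ (ℕ.∣⇒≤ p∣2) p-prime odd
  where
  not-2 : ∀ p → p ℕ.≤ 2 → Prime p → p ℕ.% 2 ≡ 1 → ⊥
  not-2 0 _ p-prime _ = ¬prime[0] p-prime
  not-2 1 _ p-prime _ = ¬prime[1] p-prime
  not-2 2 _ _     ()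
  not-2 (suc (suc (suc _))) (ℕ.s≤s (ℕ.s≤s ())) _ _

∣-prime-* : ∀ {m p z} → Prime p → ¬ p ℕ.∣ m → + m ∣ z → + p ∣ z → + (m ℕ.* p) ∣ z
∣-prime-* {m} {p} {z} p-prime p∤m (divides q z≡qm) p∣z with euclid {i = q} {j = + m} p-prime (subst (+ p ∣_) z≡qm p∣z)
... | inj₂ p∣m = ⊥-elim (p∤m (∣⇒∣ᵤ p∣m))
... | inj₁ (divides r q≡rp) = divides r (begin
  z                      ≡⟨ z≡qm ⟩
  q ℤ.* + m              ≡⟨ cong (ℤ._* + m) q≡rp ⟩
  r ℤ.* + p ℤ.* + m      ≡⟨ ℤ.*-assoc r (+ p) (+ m) ⟩
  r ℤ.* (+ p ℤ.* + m)    ≡⟨ cong (r ℤ.*_) (ℤ.*-comm (+ p) (+ m)) ⟩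
  r ℤ.* (+ m ℤ.* + p)    ≡⟨ cong (r ℤ.*_) (ℤ.pos-* m p) ⟨
  r ℤ.* + (m ℕ.* p)      ∎)
  where open ≡-Reasoning

∣-monus⇒≡mod : ∀ {b} .{{_ : NonZero b}} {u v} → v ℕ.≤ u → + b ∣ + u ℤ.- + v → u ≡[mod b ] v
∣-monus⇒≡mod {b} {u} {v} v≤u b∣u-v
  with subst (b ℕ.∣_) (cong ℤ.∣_∣ (trans (ℤ.m-n≡m⊖n u v) (ℤ.⊖-≥ v≤u))) (∣⇒∣ᵤ b∣u-v)
... | ℕ.divides k u∸v≡kb = begin
  u ℕ.% b                   ≡⟨ cong (ℕ._% b) (ℕ.m+[n∸m]≡n v≤u) ⟨
  (v ℕ.+ (u ℕ.∸ v)) ℕ.% b   ≡⟨ cong (λ d → (v ℕ.+ d) ℕ.% b) u∸v≡kb ⟩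
  (v ℕ.+ k ℕ.* b) ℕ.% b     ≡⟨ ℕ.[m+kn]%n≡m%n v k b ⟩
  v ℕ.% b                   ∎
  where open ≡-Reasoning

∣-difference⇒≡mod : ∀ {b} .{{_ : NonZero b}} {u v} → + b ∣ + u ℤ.- + v → u ≡[mod b ] v
∣-difference⇒≡mod {b} {u} {v} b∣u-v with ℕ.≤-total v u
... | inj₁ v≤u = ∣-monus⇒≡mod v≤u b∣u-v
... | inj₂ u≤v = sym (∣-monus⇒≡mod u≤v (subst (+ b ∣_) (-[u-v]≡v-u (+ u) (+ v)) (∣m⇒∣-m b∣u-v)))
  where
  -[u-v]≡v-u : ∀ U V → ℤ.- (U ℤ.- V) ≡ V ℤ.- U
  -[u-v]≡v-u = solve-∀

-- The 2-part for b = 2^e·p: 2^e divides a₁ − a₂ and a₁a₂ − 1.  (For e = 0 there is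
-- nothing to prove; otherwise b is even, so a₁ and a₂ are odd.)
two-part : ∀ e {p a₁ a₂ M} → e ℕ.≤ 3 → Coprime a₁ (2 ^ e ℕ.* p) → Coprime a₂ (2 ^ e ℕ.* p) →
           KeyIdentity (+ a₁ ℤ.- + a₂) (+ a₁ ℤ.* + a₂ ℤ.- + 1) (+ (2 ^ e ℕ.* p)) M →
           + (2 ^ e) ∣ + a₁ ℤ.- + a₂ × + (2 ^ e) ∣ + a₁ ℤ.* + a₂ ℤ.- + 1
two-part zero        _   _    _    _   = ∣ᵤ⇒∣ (ℕ.1∣ _) , ∣ᵤ⇒∣ (ℕ.1∣ _)
two-part e@(suc e-1) {p} e≤3 a₁⊥b a₂⊥b key =
  two-adic e {B = + (2 ^ e ℕ.* p)} e≤3 (coprime⇒odd a₁⊥b 2∣b) (coprime⇒odd a₂⊥b 2∣b) (∣ᵤ⇒∣ (ℕ.m∣m*n p)) key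
  where
  2∣b : 2 ℕ.∣ 2 ^ e ℕ.* p
  2∣b = ℕ.divides (2 ^ e-1 ℕ.* p) (trans (ℕ.*-assoc 2 (2 ^ e-1) p) (ℕ.*-comm 2 (2 ^ e-1 ℕ.* p)))

-- The arithmetic core: for b = 2^e·p with e ≤ 3 and p an odd prime, and a₁, a₂
-- coprime to b, the key identity forces b ∣ a₁ − a₂ or b ∣ a₁a₂ − 1: the prime
-- divides one of them, which 2^e divides as well, and p ∤ 2^e.
key⇒divisibility : ∀ {e p b a₁ a₂ M} → e ℕ.≤ 3 → Prime p → p ℕ.% 2 ≡ 1 → b ≡ 2 ^ e ℕ.* p →
  Coprime a₁ b → Coprime a₂ b → KeyIdentity (+ a₁ ℤ.- + a₂) (+ a₁ ℤ.* + a₂ ℤ.- + 1) (+ b) M →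
  + b ∣ + a₁ ℤ.- + a₂ ⊎ + b ∣ + a₁ ℤ.* + a₂ ℤ.- + 1
key⇒divisibility {e} {p} {a₁ = a₁} {a₂} e≤3 p-prime odd refl a₁⊥b a₂⊥b key =
  Sum.map (combine (proj₁ 2^e∣x,y)) (combine (proj₂ 2^e∣x,y)) (prime-part {B = + (2 ^ e ℕ.* p)} p-prime (∣ᵤ⇒∣ (ℕ.n∣m*n (2 ^ e))) key)
  where
  2^e∣x,y : + (2 ^ e) ∣ + a₁ ℤ.- + a₂ × + (2 ^ e) ∣ + a₁ ℤ.* + a₂ ℤ.- + 1
  2^e∣x,y = two-part e e≤3 a₁⊥b a₂⊥b key
  combine : ∀ {z} → + (2 ^ e) ∣ z → + p ∣ z → + (2 ^ e ℕ.* p) ∣ z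
  combine = ∣-prime-* p-prime (odd-prime∤2^ e p-prime odd)

CongruentOrInverse : (b : ℕ) .{{_ : NonZero b}} → ℕ → ℕ → Set
CongruentOrInverse b a₁ a₂ = (a₁ ≡[mod b ] a₂) ⊎ (∃[ a₂⁻¹ ] ((a₂ * a₂⁻¹ ≡[mod b ] 1) × (a₁ ≡[mod b ] a₂⁻¹)))

congruentOrInverse⇒≡ : ∀ {b} .{{_ : NonZero b}} {a₁ a₂} → CongruentOrInverse b a₁ a₂ → dedekindℤ b a₁ ≡ dedekindℤ b a₂
congruentOrInverse⇒≡ (inj₁ a₁≡a₂)                = dedekindℤ-mod a₁≡a₂
congruentOrInverse⇒≡ {a₂ = a₂} (inj₂ (c , a₂c≡1 , a₁≡c)) = trans (dedekindℤ-mod a₁≡c) (dedekindℤ-inverse c a₂ a₂c≡1)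

divisibility⇒congruentOrInverse : ∀ {b} .{{_ : NonZero b}} {a₁ a₂} →
  + b ∣ + a₁ ℤ.- + a₂ ⊎ + b ∣ + a₁ ℤ.* + a₂ ℤ.- + 1 → CongruentOrInverse b a₁ a₂
divisibility⇒congruentOrInverse (inj₁ b∣a₁-a₂)  = inj₁ (∣-difference⇒≡mod b∣a₁-a₂)
divisibility⇒congruentOrInverse {b} {a₁} {a₂} (inj₂ b∣a₁a₂-1) =
  inj₂ (a₁ , ∣-difference⇒≡mod (subst (+ b ∣_) a₁a₂-1≡ b∣a₁a₂-1) , refl)
  where
  a₁a₂-1≡ : + a₁ ℤ.* + a₂ ℤ.- + 1 ≡ + (a₂ * a₁) ℤ.- + 1
  a₁a₂-1≡ = cong (ℤ._- + 1) (trans (sym (ℤ.pos-* a₁ a₂)) (cong +_ (ℕ.*-comm a₁ a₂)))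

≡⇒divisibility : ∀ {e p b a₁ a₂} .{{_ : NonZero b}} → e ℕ.≤ 3 → Prime p → p ℕ.% 2 ≡ 1 → b ≡ 2 ^ e ℕ.* p →
  Coprime a₁ b → Coprime a₂ b → dedekindℤ b a₁ ≡ dedekindℤ b a₂ →
  + b ∣ + a₁ ℤ.- + a₂ ⊎ + b ∣ + a₁ ℤ.* + a₂ ℤ.- + 1
≡⇒divisibility {a₁ = a₁} {a₂} e≤3 p-prime odd b≡ a₁⊥b a₂⊥b D₁≡D₂
  with coprime⇒inverse a₁⊥b | coprime⇒inverse a₂⊥b
... | c₁ , c₁a₁≡1 | c₂ , c₂a₂≡1 =
  key⇒divisibility e≤3 p-prime odd b≡ a₁⊥b a₂⊥b (proj₂ (key-identity a₁ c₁ a₂ c₂ c₁a₁≡1 c₂a₂≡1 D₁≡D₂))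

mainTheorem2 : (e p b : ℕ) → e ≤ 3 → Prime p → p % 2 ≡ 1 → (b≡ : b ≡ 2 ^ e * p) → .{{_ : NonZero b}}
    → (a₁ a₂ : ℕ) → Coprime a₁ b → Coprime a₂ b
    → (dedekind a₁ b ≡ dedekind a₂ b)
      ⇔ ((a₁ ≡[mod b ] a₂) ⊎ (∃[ a₂⁻¹ ] ((a₂ * a₂⁻¹ ≡[mod b ] 1) × (a₁ ≡[mod b ] a₂⁻¹))))
mainTheorem2 e p b e≤3 p-prime odd b≡ a₁ a₂ a₁⊥b a₂⊥b =
  mk⇔ (divisibility⇒congruentOrInverse ∘ ≡⇒divisibility e≤3 p-prime odd b≡ a₁⊥b a₂⊥b ∘ to)
      (from ∘ congruentOrInverse⇒≡)
  where open Equivalence (dedekind-≡⇔ b a₁⊥b a₂⊥b)
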